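{- Let $p\ge3$. For every $n\ge1$, there is a bijection between the intervals of $\mathbb{F}_n^p$ and the bicolored Motzkin paths of length $n-1$ avoiding all $2^{p+1}-1$ patterns in the set $\{F_2,U\}^p\cup\{F_2,D\}^p$ (i.e. all words of length $p$ over $\{F_2,U\}$ and all words of length $p$ over $\{F_2,D\}$).
   Context: A Dyck path of semilength $n\ge 0$ is a lattice path from $(0,0)$ to $(2n,0)$ with steps $U=(1,1)$ and $D=(1,-1)$ that never goes below the $x$-axis; it is identified with its word over $\{U,D\}$. A path (or word) avoids a pattern $\alpha$ if $\alpha$ does not occur as a factor (block of consecutive steps). For an integer $p\ge 2$, $\mathcal{F}_n^p$ is the set of Dyck paths of semilength $n$ avoiding $DUU$ and $D^{p+1}$, ordered by the Stanley order: $P\le Q$ iff $P$ lies weakly below $Q$ when both are drawn in the plane; $\mathbb{F}_n^p=(\mathcal{F}_n^p,\le)$. An interval is a set $[P,Q]=\{R:P\le R\le Q\}$ with $P\le Q$. A bicolored Motzkin path of length $m$ is a lattice path in the quarter plane $\{y\ge0\}$ starting at $(0,0)$, consisting of $m$ steps each among $U=(1,1)$, $D=(1,-1)$, $F_1=(1,0)$, $F_2=(1,0)$ (two distinguishable kinds of flat steps), with arbitrary endpoint height; it is identified with its word over $\{U,D,F_1,F_2\}$. -}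

module Defs where

open import Data.Bool using (Bool; true; false; _∧_; _∨_; not; T)
open import Data.Nat using (ℕ; zero; suc; _*_; _≡ᵇ_)
open import Data.Integer using (ℤ; +_; _≤ᵇ_) renaming (_+_ to _+ℤ_; -_ to -ℤ_)
open import Data.List using (List; []; _∷_; length; _++_; map; concatMap)
open import Data.Product using (Σ; _×_; _,_; proj₁)

isPrefix : {A : Set} → (A → A → Bool) → List A → List A → Bool
isPrefix eq [] w = true
isPrefix eq (a ∷ u) [] = false
isPrefix eq (a ∷ u) (b ∷ w) = eq a b ∧ isPrefix eq u w

isFactor : {A : Set} → (A → A → Bool) → List A → List A → Bool
isFactor eq u [] = isPrefix eq u []
isFactor eq u (b ∷ w) = isPrefix eq u (b ∷ w) ∨ isFactor eq u w

avoids : {A : Set} → (A → A → Bool) → List A → List A → Bool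
avoids eq w u = not (isFactor eq u w)

wordsOver : {A : Set} → List A → ℕ → List (List A)
wordsOver letters zero = [] ∷ []
wordsOver letters (suc k) =
  concatMap (λ a → map (a ∷_) (wordsOver letters k)) letters

allB : {A : Set} → (A → Bool) → List A → Bool
allB f [] = true
allB f (a ∷ as) = f a ∧ allB f as

heightsFrom : {A : Set} → (A → ℤ) → ℤ → List A → List ℤ
heightsFrom δ h [] = h ∷ []
heightsFrom δ h (s ∷ w) = h ∷ heightsFrom δ (h +ℤ δ s) w

data Step : Set where
  U D : Step

stepEq : Step → Step → Bool
stepEq U U = true
stepEq D D = true
stepEq _ _ = false

δ : Step → ℤ
δ U = + 1
δ D = -ℤ (+ 1)

heights : List Step → List ℤ
heights = heightsFrom δ (+ 0)

-- last element of a nonempty list of heights (0 for empty, never used)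
lastℤ : List ℤ → ℤ
lastℤ [] = + 0
lastℤ (h ∷ []) = h
lastℤ (h ∷ h' ∷ hs) = lastℤ (h' ∷ hs)

isDyck : ℕ → List Step → Bool
isDyck n w = (length w ≡ᵇ 2 * n)
           ∧ allB (λ h → + 0 ≤ᵇ h) (heights w)
           ∧ ((lastℤ (heights w) ≤ᵇ + 0) ∧ (+ 0 ≤ᵇ lastℤ (heights w)))

Dpow : ℕ → List Step
Dpow zero = []
Dpow (suc k) = D ∷ Dpow k

inF : ℕ → ℕ → List Step → Bool
inF p n w = isDyck n w
          ∧ avoids stepEq w (D ∷ U ∷ U ∷ [])
          ∧ avoids stepEq w (Dpow (suc p))

𝓕 : ℕ → ℕ → Set
𝓕 p n = Σ (List Step) (λ w → T (inF p n w))

allLe : List ℤ → List ℤ → Bool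
allLe [] [] = true
allLe (a ∷ as) (b ∷ bs) = (a ≤ᵇ b) ∧ allLe as bs
allLe _ _ = false

stanleyLe : List Step → List Step → Bool
stanleyLe P Q = allLe (heights P) (heights Q)

-- intervals [P,Q] of 𝔽_n^p, identified with pairs (P,Q) with P ≤ Q
Interval : ℕ → ℕ → Set
Interval p n =
  Σ (𝓕 p n × 𝓕 p n) (λ PQ → T (stanleyLe (proj₁ (proj₁ PQ)) (proj₁ (Data.Product.proj₂ PQ))))

data MStep : Set where
  MU MD F₁ F₂ : MStep

mstepEq : MStep → MStep → Bool
mstepEq MU MU = true
mstepEq MD MD = true
mstepEq F₁ F₁ = true
mstepEq F₂ F₂ = true
mstepEq _ _ = false

mδ : MStep → ℤ
mδ MU = + 1
mδ MD = -ℤ (+ 1)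
mδ F₁ = + 0
mδ F₂ = + 0

-- bicolored Motzkin path of length m: m steps, never below the x-axis,
-- arbitrary endpoint height
isBiMotzkin : ℕ → List MStep → Bool
isBiMotzkin m w = (length w ≡ᵇ m) ∧ allB (λ h → + 0 ≤ᵇ h) (heightsFrom mδ (+ 0) w)

forbidden : ℕ → List (List MStep)
forbidden p = wordsOver (F₂ ∷ MU ∷ []) p ++ wordsOver (F₂ ∷ MD ∷ []) p

avoidsAll : ℕ → List MStep → Bool
avoidsAll p w = allB (avoids mstepEq w) (forbidden p)

Motz : ℕ → ℕ → Set
Motz p m = Σ (List MStep) (λ w → T (isBiMotzkin m w ∧ avoidsAll p w))

{-# OPTIONS --safe #-}
-- A Dyck path avoids DUU iff after its first down step every up step is immediately followed
-- by a down step, i.e. it is U^(1+k) D followed by a word in the blocks UD and D, k of them D.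
-- Writing true for UD and false for D identifies these paths of semilength n with the binary
-- words of length n-1; D^(p+1) occurs iff the word has p consecutive letters false.
-- A path P lies below Q iff for every i the i-th down step of P comes no later than that of Q;
-- for encoded words x, y this says that every suffix of x has at least as many letters true as
-- the suffix of y of the same length.  Zipping x and y into U = (true,false), D = (false,true),
-- F₁ = (true,true), F₂ = (false,false) and reading the result from the end turns these suffix
-- counts into the heights of a bicolored Motzkin path, and runs of false in x and in y into
-- the patterns {F₂,D}^p and {F₂,U}^p.

module Submission where

open import Defs
open import Data.Nat using (ℕ; _≤_; _∸_)
open import Function.Bundles using (_⤖_)

open import Data.Nat as ℕ using (zero; suc; _+_; _≡ᵇ_; _≤ᵇ_; z≤n; s≤s)
import Data.Nat.Properties as ℕP
open import Data.Integer as ℤ using (ℤ; +_; -[1+_])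
import Data.Integer.Properties as ℤP
open import Data.Integer.Tactic.RingSolver using (solve-∀)
open import Data.Bool using (Bool; true; false; _∧_; _∨_; not; T)
open import Data.Bool.Properties
  using (T-irrelevant; T-≡; T-∧; T-∨; ⇔→≡; ∧-assoc; ∧-comm; ∧-identityʳ; ∧-zeroʳ; ∧-distribʳ-∨;
         ∨-assoc; ∨-identityʳ; ∨-zeroʳ)
open import Data.Bool.ListAction using (any; or)
open import Data.List
  using (List; []; _∷_; _++_; _∷ʳ_; length; map; replicate; reverse; concatMap; foldl; zipWith; unzipWith)
import Data.List.Properties as ListP
import Data.Product as Product
open import Data.Product using (Σ; ∃₂; _×_; _,_; proj₁; proj₂; uncurry′)
open import Data.Sum using (inj₁; inj₂)
open import Function.Base using (_∘_; _∋_)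
open import Function.Bundles using (_↔_; mk↔ₛ′; Equivalence; mk⇔)
open import Function.Construct.Composition using (_↔-∘_)
open import Function.Properties.Inverse using (↔⇒⤖)
open import Relation.Binary.PropositionalEquality
open import Relation.Nullary using (contradiction)

open Equivalence using (to; from)

T-ext : ∀ {a b} → (T a → T b) → (T b → T a) → a ≡ b
T-ext f g = ⇔→≡ {z = true} (mk⇔ (to T-≡ ∘ f ∘ from T-≡) (to T-≡ ∘ g ∘ from T-≡))

∧-cong-T : ∀ a {b c} → (T a → b ≡ c) → a ∧ b ≡ a ∧ c
∧-cong-T true b≡c = b≡c _
∧-cong-T false _ = refl

∧-shuffle : ∀ l a b s → (l ∧ a) ∧ ((l ∧ b) ∧ s) ≡ (l ∧ s) ∧ (b ∧ a)
∧-shuffle false a b s = refl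
∧-shuffle true a b true = trans (cong (a ∧_) (∧-identityʳ b)) (∧-comm a b)
∧-shuffle true a b false = trans (cong (a ∧_) (∧-zeroʳ b)) (∧-zeroʳ a)

any-++ : ∀ {A : Set} (f : A → Bool) xs ys → any f (xs ++ ys) ≡ any f xs ∨ any f ys
any-++ f [] ys = refl
any-++ f (x ∷ xs) ys = trans (cong (f x ∨_) (any-++ f xs ys)) (sym (∨-assoc (f x) _ _))

any-concatMap : ∀ {A B : Set} (f : B → Bool) (g : A → List B) xs → any f (concatMap g xs) ≡ any (any f ∘ g) xs
any-concatMap f g [] = refl
any-concatMap f g (x ∷ xs) = trans (any-++ f (g x) (concatMap g xs)) (cong (any f (g x) ∨_) (any-concatMap f g xs))

any-map : ∀ {A B : Set} (f : B → Bool) (g : A → B) xs → any f (map g xs) ≡ any (f ∘ g) xs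
any-map f g xs = cong or (sym (ListP.map-∘ xs))

any-cong : ∀ {A : Set} {f g : A → Bool} → (∀ x → f x ≡ g x) → ∀ xs → any f xs ≡ any g xs
any-cong f≗g xs = cong or (ListP.map-cong f≗g xs)

any-false : ∀ {A : Set} (xs : List A) → any (λ _ → false) xs ≡ false
any-false [] = refl
any-false (_ ∷ xs) = any-false xs

any-∧ˡ : ∀ {A : Set} c (f : A → Bool) xs → any (λ x → c ∧ f x) xs ≡ c ∧ any f xs
any-∧ˡ true f xs = refl
any-∧ˡ false f xs = any-false xs

any-∧ʳ : ∀ {A : Set} (f : A → Bool) c xs → any (λ x → f x ∧ c) xs ≡ any f xs ∧ c
any-∧ʳ f c [] = refl
any-∧ʳ f c (x ∷ xs) = trans (cong ((f x ∧ c) ∨_) (any-∧ʳ f c xs)) (sym (∧-distribʳ-∨ c (f x) (any f xs)))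

any-∨ : ∀ {A : Set} (f g : A → Bool) xs → any (λ x → f x ∨ g x) xs ≡ any f xs ∨ any g xs
any-∨ f g [] = refl
any-∨ f g (x ∷ xs) = trans (cong ((f x ∨ g x) ∨_) (any-∨ f g xs)) (interchange (f x) (g x) (any f xs) (any g xs))
  where
  interchange : ∀ a b c d → (a ∨ b) ∨ (c ∨ d) ≡ (a ∨ c) ∨ (b ∨ d)
  interchange true b c d = refl
  interchange false true c d = sym (∨-zeroʳ c)
  interchange false false c d = refl

allB-++ : ∀ {A : Set} (f : A → Bool) xs ys → allB f (xs ++ ys) ≡ allB f xs ∧ allB f ys
allB-++ f [] ys = refl
allB-++ f (x ∷ xs) ys = trans (cong (f x ∧_) (allB-++ f xs ys)) (sym (∧-assoc (f x) _ _))

allB-∷ʳ : ∀ {A : Set} (f : A → Bool) xs x → allB f (xs ∷ʳ x) ≡ allB f xs ∧ f x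
allB-∷ʳ f xs x = trans (allB-++ f xs (x ∷ [])) (cong (allB f xs ∧_) (∧-identityʳ (f x)))

allB-not : ∀ {A : Set} (f : A → Bool) xs → allB (not ∘ f) xs ≡ not (any f xs)
allB-not f [] = refl
allB-not f (x ∷ xs) with f x
... | true = refl
... | false = allB-not f xs

++-replicate-∷ : ∀ {A : Set} k (x : A) xs → replicate k x ++ x ∷ xs ≡ x ∷ replicate k x ++ xs
++-replicate-∷ zero x xs = refl
++-replicate-∷ (suc k) x xs = cong (x ∷_) (++-replicate-∷ k x xs)

reverse-replicate : ∀ {A : Set} q (x : A) → reverse (replicate q x) ≡ replicate q x
reverse-replicate zero x = refl
reverse-replicate (suc q) x = begin
  reverse (x ∷ replicate q x)       ≡⟨ ListP.unfold-reverse x (replicate q x) ⟩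
  reverse (replicate q x) ∷ʳ x      ≡⟨ cong (_∷ʳ x) (reverse-replicate q x) ⟩
  replicate q x ++ x ∷ []           ≡⟨ ++-replicate-∷ q x [] ⟩
  x ∷ replicate q x ++ []           ≡⟨ cong (x ∷_) (ListP.++-identityʳ (replicate q x)) ⟩
  x ∷ replicate q x                 ∎
  where open ≡-Reasoning

proj₁-unzipWith : ∀ {A B C : Set} (f : A → B × C) xs → proj₁ (unzipWith f xs) ≡ map (proj₁ ∘ f) xs
proj₁-unzipWith f [] = refl
proj₁-unzipWith f (x ∷ xs) = cong (proj₁ (f x) ∷_) (proj₁-unzipWith f xs)

proj₂-unzipWith : ∀ {A B C : Set} (f : A → B × C) xs → proj₂ (unzipWith f xs) ≡ map (proj₂ ∘ f) xs
proj₂-unzipWith f [] = refl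
proj₂-unzipWith f (x ∷ xs) = cong (proj₂ (f x) ∷_) (proj₂-unzipWith f xs)

module _ {A : Set} {P : A → Bool} where

  subset-≡ : ∀ {a a′} {t : T (P a)} {t′ : T (P a′)} → a ≡ a′ → (Σ A (T ∘ P) ∋ (a , t)) ≡ (a′ , t′)
  subset-≡ {t = t} {t′} refl = cong (_ ,_) (T-irrelevant t t′)

restrict↔ : {A B : Set} {P : A → Bool} {Q : B → Bool} (f : A → B) (g : B → A) →
            (∀ a → Q (f a) ≡ P a) → (∀ a → g (f a) ≡ a) → (∀ b → T (Q b) → f (g b) ≡ b) →
            Σ B (T ∘ Q) ↔ Σ A (T ∘ P)
restrict↔ {A} {B} {P} {Q} f g Q∘f≡P g∘f≡id f∘g≡id = mk↔ₛ′ g′ f′ g′∘f′ f′∘g′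
  where
  f′ : Σ A (T ∘ P) → Σ B (T ∘ Q)
  f′ (a , t) = f a , subst T (sym (Q∘f≡P a)) t
  g′ : Σ B (T ∘ Q) → Σ A (T ∘ P)
  g′ (b , t) = g b , subst T (Q∘f≡P (g b)) (subst (T ∘ Q) (sym (f∘g≡id b t)) t)
  g′∘f′ : ∀ a → g′ (f′ a) ≡ a
  g′∘f′ (a , _) = subset-≡ (g∘f≡id a)
  f′∘g′ : ∀ b → f′ (g′ b) ≡ b
  f′∘g′ (b , t) = subset-≡ (f∘g≡id b t)

bothIn : {A : Set} → (A → Bool) → (A → A → Bool) → A × A → Bool
bothIn P R (a , b) = P a ∧ (P b ∧ R a b)

pairsIn↔ : {A : Set} {P : A → Bool} (R : A → A → Bool) →
           Σ (Σ A (T ∘ P) × Σ A (T ∘ P)) (λ ab → T (R (proj₁ (proj₁ ab)) (proj₁ (proj₂ ab)))) ↔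
           Σ (A × A) (T ∘ bothIn P R)
pairsIn↔ {A} {P} R = mk↔ₛ′ join split join∘split split∘join
  where
  join : Σ (Σ A (T ∘ P) × Σ A (T ∘ P)) (λ ab → T (R (proj₁ (proj₁ ab)) (proj₁ (proj₂ ab)))) →
         Σ (A × A) (T ∘ bothIn P R)
  join (((a , s) , (b , t)) , r) = (a , b) , from (T-∧ {P a}) (s , from (T-∧ {P b}) (t , r))
  split : Σ (A × A) (T ∘ bothIn P R) →
          Σ (Σ A (T ∘ P) × Σ A (T ∘ P)) (λ ab → T (R (proj₁ (proj₁ ab)) (proj₁ (proj₂ ab))))
  split ((a , b) , str) =
    let s , tr = to (T-∧ {P a}) str
        t , r = to (T-∧ {P b}) tr
    in ((a , s) , (b , t)) , r
  join∘split : ∀ x → join (split x) ≡ x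
  join∘split ((a , b) , _) = cong ((a , b) ,_) (T-irrelevant _ _)
  split∘join : ∀ x → split (join x) ≡ x
  split∘join x@(((a , s) , (b , t)) , r) =
    trans (cong₂ (λ s′ t′ → ((a , s′) , (b , t′)) , proj₂ (split (join x)))
                 (T-irrelevant _ s) (T-irrelevant _ t))
          (cong (_ ,_) (T-irrelevant _ r))

belowFrom : ℤ → ℤ → List Step → List Step → Bool
belowFrom h h′ P Q = allLe (heightsFrom δ h P) (heightsFrom δ h′ Q)

-- below e P Q: Q, started 2e above P, never goes below P.
below : ℕ → List Step → List Step → Bool
below e [] [] = true
below e [] (_ ∷ _) = false
below e (_ ∷ _) [] = false
below e (U ∷ P) (U ∷ Q) = below e P Q
below e (D ∷ P) (D ∷ Q) = below e P Q
below e (D ∷ P) (U ∷ Q) = below (suc e) P Q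
below zero (U ∷ P) (D ∷ Q) = false
below (suc e) (U ∷ P) (D ∷ Q) = below e P Q

gap : ℕ → ℤ
gap e = + (e + e)

gap-suc : ∀ e → gap (suc e) ≡ gap e ℤ.+ + 2
gap-suc e = trans (cong (+_ ∘ suc) (ℕP.+-suc e e)) (trans (cong +_ (ℕP.+-comm 2 (e + e))) (ℤP.pos-+ (e + e) 2))

≤ᵇ-gap : ∀ h e → (h ℤ.≤ᵇ h ℤ.+ gap e) ≡ true
≤ᵇ-gap h e = to T-≡ (ℤP.≤⇒≤ᵇ (ℤP.i≤i+j h (gap e)))

≤ᵇ-false : ∀ {i j} → j ℤ.< i → (i ℤ.≤ᵇ j) ≡ false
≤ᵇ-false {i} {j} j<i with i ℤ.≤ᵇ j in eq
... | false = refl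
... | true = contradiction (ℤP.≤ᵇ⇒≤ (subst T (sym eq) _)) (ℤP.<⇒≱ j<i)

belowFrom-violated : ∀ {h h′} P Q → h′ ℤ.< h → belowFrom h h′ P Q ≡ false
belowFrom-violated [] [] h′<h rewrite ≤ᵇ-false h′<h = refl
belowFrom-violated [] (_ ∷ _) h′<h rewrite ≤ᵇ-false h′<h = refl
belowFrom-violated (_ ∷ _) [] h′<h rewrite ≤ᵇ-false h′<h = refl
belowFrom-violated (_ ∷ _) (_ ∷ _) h′<h rewrite ≤ᵇ-false h′<h = refl

swap-last : ∀ h g d → (h ℤ.+ g) ℤ.+ d ≡ (h ℤ.+ d) ℤ.+ g
swap-last = solve-∀

gap-widens : ∀ h g → (h ℤ.+ g) ℤ.+ + 1 ≡ (h ℤ.+ -[1+ 0 ]) ℤ.+ (g ℤ.+ + 2)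
gap-widens = solve-∀

gap-narrows : ∀ h g → (h ℤ.+ (g ℤ.+ + 2)) ℤ.+ -[1+ 0 ] ≡ (h ℤ.+ + 1) ℤ.+ g
gap-narrows = solve-∀

gap-closes : ∀ h → (h ℤ.+ + 1) ≡ ((h ℤ.+ + 0) ℤ.+ -[1+ 0 ]) ℤ.+ + 2
gap-closes = solve-∀

belowFrom-slack : ∀ e h P Q → belowFrom h (h ℤ.+ gap e) P Q ≡ below e P Q
belowFrom-slack e h [] [] rewrite ≤ᵇ-gap h e = refl
belowFrom-slack e h [] (_ ∷ []) rewrite ≤ᵇ-gap h e = refl
belowFrom-slack e h [] (_ ∷ _ ∷ _) rewrite ≤ᵇ-gap h e = refl
belowFrom-slack e h (_ ∷ []) [] rewrite ≤ᵇ-gap h e = refl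
belowFrom-slack e h (_ ∷ _ ∷ _) [] rewrite ≤ᵇ-gap h e = refl
belowFrom-slack e h (U ∷ P) (U ∷ Q) rewrite ≤ᵇ-gap h e =
  trans (cong (λ h′ → belowFrom (h ℤ.+ + 1) h′ P Q) (swap-last h (gap e) (+ 1)))
        (belowFrom-slack e (h ℤ.+ + 1) P Q)
belowFrom-slack e h (D ∷ P) (D ∷ Q) rewrite ≤ᵇ-gap h e =
  trans (cong (λ h′ → belowFrom (h ℤ.+ -[1+ 0 ]) h′ P Q) (swap-last h (gap e) -[1+ 0 ]))
        (belowFrom-slack e (h ℤ.+ -[1+ 0 ]) P Q)
belowFrom-slack e h (D ∷ P) (U ∷ Q) rewrite ≤ᵇ-gap h e =
  trans (cong (λ h′ → belowFrom (h ℤ.+ -[1+ 0 ]) h′ P Q)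
              (trans (gap-widens h (gap e)) (cong (λ g → (h ℤ.+ -[1+ 0 ]) ℤ.+ g) (sym (gap-suc e)))))
        (belowFrom-slack (suc e) (h ℤ.+ -[1+ 0 ]) P Q)
belowFrom-slack zero h (U ∷ P) (D ∷ Q) rewrite ≤ᵇ-gap h zero =
  belowFrom-violated P Q (subst (k ℤ.<_) (sym (gap-closes h)) k<k+2)
  where
  k : ℤ
  k = (h ℤ.+ + 0) ℤ.+ -[1+ 0 ]
  k<k+2 : k ℤ.< k ℤ.+ + 2
  k<k+2 = subst (ℤ._< k ℤ.+ + 2) (ℤP.+-identityʳ k) (ℤP.+-monoʳ-< k (ℤ.+<+ (s≤s z≤n)))
belowFrom-slack (suc e) h (U ∷ P) (D ∷ Q) rewrite ≤ᵇ-gap h (suc e) =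
  trans (cong (λ h′ → belowFrom (h ℤ.+ + 1) h′ P Q)
              (trans (cong (λ g → (h ℤ.+ g) ℤ.+ -[1+ 0 ]) (gap-suc e)) (gap-narrows h (gap e))))
        (belowFrom-slack e (h ℤ.+ + 1) P Q)

ascents : List ℕ → List Step
ascents [] = []
ascents (a ∷ as) = replicate a U ++ D ∷ ascents as

length-ascent : ∀ a W → length (replicate a U ++ D ∷ W) ≡ suc (a + length W)
length-ascent zero W = refl
length-ascent (suc a) W = cong suc (length-ascent a W)

≤ᵇ-suc : ∀ m n → (suc m ≤ᵇ suc n) ≡ (m ≤ᵇ n)
≤ᵇ-suc zero n = refl
≤ᵇ-suc (suc m) n = refl

-- belowAscents e α β as bs: whenever U^β D (ascents bs) has an (e+i)-th down step,
-- U^α D (ascents as) has an i-th one, at the same position or earlier.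
belowAscents : ℕ → ℕ → ℕ → List ℕ → List ℕ → Bool
belowAscents zero α β [] [] = α ≤ᵇ β
belowAscents zero α β (_ ∷ _) [] = α ≤ᵇ β
belowAscents zero α β [] (_ ∷ _) = false
belowAscents zero α β (a ∷ as) (b ∷ bs) = (α ≤ᵇ β) ∧ belowAscents zero (α + a) (β + b) as bs
belowAscents (suc e) α β as [] = true
belowAscents (suc e) α β as (b ∷ bs) = belowAscents e α (suc (β + b)) as bs

belowAscents-suc : ∀ e α β as bs → belowAscents e (suc α) (suc β) as bs ≡ belowAscents e α β as bs
belowAscents-suc zero α β [] [] = ≤ᵇ-suc α β
belowAscents-suc zero α β (_ ∷ _) [] = ≤ᵇ-suc α β
belowAscents-suc zero α β [] (_ ∷ _) = refl
belowAscents-suc zero α β (a ∷ as) (b ∷ bs) =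
  cong₂ _∧_ (≤ᵇ-suc α β) (belowAscents-suc zero (α + a) (β + b) as bs)
belowAscents-suc (suc e) α β as [] = refl
belowAscents-suc (suc e) α β as (b ∷ bs) = belowAscents-suc e α (suc (β + b)) as bs

belowAscents-zero : ∀ e β a as b bs → belowAscents e 0 β (a ∷ as) (b ∷ bs) ≡ belowAscents e a (β + b) as bs
belowAscents-zero zero β a as b bs = refl
belowAscents-zero (suc zero) β a as b [] = refl
belowAscents-zero (suc (suc e)) β a as b [] = refl
belowAscents-zero (suc e) β a as b (b′ ∷ bs) = belowAscents-zero e (suc (β + b)) a as b′ bs

belowAscents-[] : ∀ e β a as → belowAscents e 0 β (a ∷ as) [] ≡ true
belowAscents-[] zero β a as = refl
belowAscents-[] (suc e) β a as = refl

below-ascents : ∀ e α β as bs → length (ascents (α ∷ as)) ≡ length (ascents (β ∷ bs)) →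
                below e (ascents (α ∷ as)) (ascents (β ∷ bs)) ≡ belowAscents e α β as bs
below-ascents e (suc α) (suc β) as bs eq =
  trans (below-ascents e α β as bs (ℕP.suc-injective eq)) (sym (belowAscents-suc e α β as bs))
below-ascents zero zero zero [] [] eq = refl
below-ascents (suc e) zero zero [] [] eq = refl
below-ascents e zero zero [] (b ∷ bs) eq =
  contradiction (trans (ℕP.suc-injective eq) (length-ascent b (ascents bs))) ℕP.0≢1+n
below-ascents e zero zero (a ∷ as) [] eq =
  contradiction (trans (sym (ℕP.suc-injective eq)) (length-ascent a (ascents as))) ℕP.0≢1+n
below-ascents e zero zero (a ∷ as) (b ∷ bs) eq =
  trans (below-ascents e a b as bs (ℕP.suc-injective eq)) (sym (belowAscents-zero e 0 a as b bs))
below-ascents e zero (suc β) [] bs eq =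
  contradiction (trans (ℕP.suc-injective eq) (length-ascent β (ascents bs))) ℕP.0≢1+n
below-ascents e zero (suc β) (a ∷ as) [] eq =
  trans (below-ascents (suc e) a β as [] (ℕP.suc-injective eq)) (sym (belowAscents-[] e (suc β) a as))
below-ascents e zero (suc β) (a ∷ as) (b ∷ bs) eq =
  trans (below-ascents (suc e) a β as (b ∷ bs) (ℕP.suc-injective eq)) (sym (belowAscents-zero e (suc β) a as b bs))
below-ascents zero (suc α) zero [] [] eq = refl
below-ascents zero (suc α) zero [] (_ ∷ _) eq = refl
below-ascents zero (suc α) zero (_ ∷ _) [] eq = refl
below-ascents zero (suc α) zero (_ ∷ _) (_ ∷ _) eq = refl
below-ascents (suc e) (suc α) zero as [] eq =
  contradiction (trans (sym (ℕP.suc-injective eq)) (length-ascent α (ascents as))) ℕP.0≢1+n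
below-ascents (suc e) (suc α) zero as (b ∷ bs) eq =
  trans (below-ascents e α b as bs (ℕP.suc-injective eq)) (sym (belowAscents-suc e α b as bs))

-- DUU-avoiding Dyck paths as binary words

stepsOf : List Bool → List Step
stepsOf [] = []
stepsOf (true ∷ w) = U ∷ D ∷ stepsOf w
stepsOf (false ∷ w) = D ∷ stepsOf w

falses : List Bool → ℕ
falses [] = 0
falses (true ∷ w) = falses w
falses (false ∷ w) = suc (falses w)

encode : List Bool → List Step
encode w = replicate (suc (falses w)) U ++ D ∷ stepsOf w

returnsFrom : ℕ → List Step → Bool
returnsFrom c [] = c ≡ᵇ 0
returnsFrom c (U ∷ W) = returnsFrom (suc c) W
returnsFrom zero (D ∷ W) = false
returnsFrom (suc c) (D ∷ W) = returnsFrom c W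

nonneg : ℤ → Bool
nonneg h = + 0 ℤ.≤ᵇ h

onAxis : ℤ → Bool
onAxis h = (h ℤ.≤ᵇ + 0) ∧ (+ 0 ℤ.≤ᵇ h)

lastℤ-∷ : ∀ {A : Set} (f : A → ℤ) h h′ W → lastℤ (h ∷ heightsFrom f h′ W) ≡ lastℤ (heightsFrom f h′ W)
lastℤ-∷ f h h′ [] = refl
lastℤ-∷ f h h′ (_ ∷ _) = refl

heights-returnsFrom : ∀ c W →
  (allB nonneg (heightsFrom δ (+ c) W) ∧ onAxis (lastℤ (heightsFrom δ (+ c) W))) ≡ returnsFrom c W
heights-returnsFrom zero [] = refl
heights-returnsFrom (suc c) [] = refl
heights-returnsFrom c (U ∷ W) =
  trans (cong (λ h → allB nonneg (heightsFrom δ h W) ∧ onAxis (lastℤ (+ c ∷ heightsFrom δ h W)))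
              (cong +_ (ℕP.+-comm c 1)))
        (trans (cong (λ h → allB nonneg (heightsFrom δ (+ suc c) W) ∧ onAxis h) (lastℤ-∷ δ (+ c) (+ suc c) W))
               (heights-returnsFrom (suc c) W))
heights-returnsFrom zero (D ∷ []) = refl
heights-returnsFrom zero (D ∷ _ ∷ _) = refl
heights-returnsFrom (suc c) (D ∷ W) =
  trans (cong (λ h → allB nonneg (heightsFrom δ (+ c) W) ∧ onAxis h) (lastℤ-∷ δ (+ suc c) (+ c) W))
        (heights-returnsFrom c W)

isDyck-returnsFrom : ∀ n W → isDyck n W ≡ (length W ≡ᵇ 2 ℕ.* n) ∧ returnsFrom 0 W
isDyck-returnsFrom n W = cong ((length W ≡ᵇ 2 ℕ.* n) ∧_) (heights-returnsFrom 0 W)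

returnsFrom-ups : ∀ c k X → returnsFrom c (replicate k U ++ X) ≡ returnsFrom (k + c) X
returnsFrom-ups c zero X = refl
returnsFrom-ups c (suc k) X = trans (returnsFrom-ups (suc c) k X) (cong (λ c′ → returnsFrom c′ X) (ℕP.+-suc k c))

returnsFrom-stepsOf : ∀ c w → returnsFrom c (stepsOf w) ≡ (c ≡ᵇ falses w)
returnsFrom-stepsOf c [] = refl
returnsFrom-stepsOf c (true ∷ w) = returnsFrom-stepsOf c w
returnsFrom-stepsOf zero (false ∷ w) = refl
returnsFrom-stepsOf (suc c) (false ∷ w) = returnsFrom-stepsOf c w

returnsFrom-encode : ∀ w → returnsFrom 0 (encode w) ≡ true
returnsFrom-encode w = begin
  returnsFrom 0 (encode w)
    ≡⟨ returnsFrom-ups 0 (suc (falses w)) (D ∷ stepsOf w) ⟩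
  returnsFrom (suc (falses w) + 0) (D ∷ stepsOf w)
    ≡⟨ cong (λ c → returnsFrom c (D ∷ stepsOf w)) (ℕP.+-identityʳ (suc (falses w))) ⟩
  returnsFrom (falses w) (stepsOf w)
    ≡⟨ returnsFrom-stepsOf (falses w) w ⟩
  (falses w ≡ᵇ falses w)
    ≡⟨ to T-≡ (ℕP.≡⇒≡ᵇ (falses w) (falses w) refl) ⟩
  true
    ∎
  where open ≡-Reasoning

length-stepsOf : ∀ w → falses w + length (stepsOf w) ≡ length w + length w
length-stepsOf [] = refl
length-stepsOf (true ∷ w) = begin
  falses w + suc (suc (length (stepsOf w)))   ≡⟨ ℕP.+-suc _ _ ⟩
  suc (falses w + suc (length (stepsOf w)))   ≡⟨ cong suc (ℕP.+-suc _ _) ⟩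
  suc (suc (falses w + length (stepsOf w)))   ≡⟨ cong (suc ∘ suc) (length-stepsOf w) ⟩
  suc (suc (length w + length w))             ≡⟨ cong suc (ℕP.+-suc _ _) ⟨
  suc (length w + suc (length w))             ∎
  where open ≡-Reasoning
length-stepsOf (false ∷ w) = cong suc (begin
  falses w + suc (length (stepsOf w))   ≡⟨ ℕP.+-suc _ _ ⟩
  suc (falses w + length (stepsOf w))   ≡⟨ cong suc (length-stepsOf w) ⟩
  suc (length w + length w)             ≡⟨ ℕP.+-suc _ _ ⟨
  length w + suc (length w)             ∎)
  where open ≡-Reasoning

length-encode : ∀ w → length (encode w) ≡ suc (length w) + suc (length w)
length-encode w = begin
  length (encode w)                                ≡⟨ length-ascent (suc (falses w)) (stepsOf w) ⟩
  suc (suc (falses w + length (stepsOf w)))        ≡⟨ cong (suc ∘ suc) (length-stepsOf w) ⟩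
  suc (suc (length w + length w))                  ≡⟨ cong suc (ℕP.+-suc _ _) ⟨
  suc (length w) + suc (length w)                  ∎
  where open ≡-Reasoning

double-≡ᵇ : ∀ a b → (a + a ≡ᵇ b + b) ≡ (a ≡ᵇ b)
double-≡ᵇ zero zero = refl
double-≡ᵇ zero (suc b) = refl
double-≡ᵇ (suc a) zero = refl
double-≡ᵇ (suc a) (suc b) = trans (cong₂ _≡ᵇ_ (ℕP.+-suc a a) (ℕP.+-suc b b)) (double-≡ᵇ a b)

length-encode-≡ᵇ : ∀ w m → (length (encode w) ≡ᵇ 2 ℕ.* suc m) ≡ (length w ≡ᵇ m)
length-encode-≡ᵇ w m =
  trans (cong₂ _≡ᵇ_ (length-encode w) (cong (λ k → suc m + k) (ℕP.+-identityʳ (suc m))))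
        (double-≡ᵇ (suc (length w)) (suc m))

DUU : List Step
DUU = D ∷ U ∷ U ∷ []

factor-ups : ∀ u k X → isFactor stepEq (D ∷ u) (replicate k U ++ X) ≡ isFactor stepEq (D ∷ u) X
factor-ups u zero X = refl
factor-ups u (suc k) X = factor-ups u k X

no-DUU : ∀ w → isFactor stepEq DUU (D ∷ stepsOf w) ≡ false
no-DUU [] = refl
no-DUU (true ∷ w) = no-DUU w
no-DUU (false ∷ w) = no-DUU w

startsWithFalses : ℕ → List Bool → Bool
startsWithFalses zero _ = true
startsWithFalses (suc q) [] = false
startsWithFalses (suc q) (b ∷ w) = not b ∧ startsWithFalses q w

hasFalseRun : ℕ → List Bool → Bool
hasFalseRun q [] = startsWithFalses q []
hasFalseRun q (b ∷ w) = startsWithFalses q (b ∷ w) ∨ hasFalseRun q w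

prefix-Dpow : ∀ q w → isPrefix stepEq (Dpow q) (stepsOf w) ≡ startsWithFalses q w
prefix-Dpow zero w = refl
prefix-Dpow (suc q) [] = refl
prefix-Dpow (suc q) (true ∷ w) = refl
prefix-Dpow (suc q) (false ∷ w) = prefix-Dpow q w

factor-Dpow : ∀ p w → isFactor stepEq (Dpow (suc p)) (D ∷ stepsOf w) ≡ hasFalseRun p w
factor-Dpow p [] = trans (∨-identityʳ _) (prefix-Dpow p [])
factor-Dpow p (true ∷ w) = cong₂ _∨_ (prefix-Dpow p (true ∷ w)) (factor-Dpow p w)
factor-Dpow p (false ∷ w) = cong₂ _∨_ (prefix-Dpow p (false ∷ w)) (factor-Dpow p w)

isCodeWord : ℕ → ℕ → List Bool → Bool
isCodeWord p m w = (length w ≡ᵇ m) ∧ not (hasFalseRun p w)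

inF-encode : ∀ p m w → inF p (suc m) (encode w) ≡ isCodeWord p m w
inF-encode p m w = begin
  inF p (suc m) (encode w)
    ≡⟨ cong₂ _∧_ (isDyck-returnsFrom (suc m) (encode w))
                 (cong₂ (λ a b → not a ∧ not b) avoidsDUU avoidsDpow) ⟩
  ((length (encode w) ≡ᵇ 2 ℕ.* suc m) ∧ returnsFrom 0 (encode w)) ∧ (true ∧ not (hasFalseRun p w))
    ≡⟨ cong₂ (λ a b → (a ∧ b) ∧ not (hasFalseRun p w)) (length-encode-≡ᵇ w m) (returnsFrom-encode w) ⟩
  ((length w ≡ᵇ m) ∧ true) ∧ not (hasFalseRun p w)
    ≡⟨ cong (_∧ not (hasFalseRun p w)) (∧-identityʳ _) ⟩
  isCodeWord p m w
    ∎
  where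
  open ≡-Reasoning
  avoidsDUU : isFactor stepEq DUU (encode w) ≡ false
  avoidsDUU = trans (factor-ups (U ∷ U ∷ []) (suc (falses w)) (D ∷ stepsOf w)) (no-DUU w)
  avoidsDpow : isFactor stepEq (Dpow (suc p)) (encode w) ≡ hasFalseRun p w
  avoidsDpow = trans (factor-ups (Dpow p) (suc (falses w)) (D ∷ stepsOf w)) (factor-Dpow p w)

isCodeWord-length : ∀ p m w → T (isCodeWord p m w) → length w ≡ m
isCodeWord-length p m w ok = ℕP.≡ᵇ⇒≡ (length w) m (proj₁ (to (T-∧ {length w ≡ᵇ m}) ok))

decodeSteps : List Step → List Bool
decodeSteps [] = []
decodeSteps (D ∷ W) = false ∷ decodeSteps W
decodeSteps (U ∷ []) = true ∷ []
decodeSteps (U ∷ _ ∷ W) = true ∷ decodeSteps W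

decode : List Step → List Bool
decode [] = []
decode (U ∷ W) = decode W
decode (D ∷ W) = decodeSteps W

decode-encode : ∀ w → decode (encode w) ≡ w
decode-encode w = decode-ups (suc (falses w))
  where
  decodeSteps-stepsOf : ∀ w → decodeSteps (stepsOf w) ≡ w
  decodeSteps-stepsOf [] = refl
  decodeSteps-stepsOf (true ∷ w) = cong (true ∷_) (decodeSteps-stepsOf w)
  decodeSteps-stepsOf (false ∷ w) = cong (false ∷_) (decodeSteps-stepsOf w)
  decode-ups : ∀ k → decode (replicate k U ++ D ∷ stepsOf w) ≡ w
  decode-ups zero = decodeSteps-stepsOf w
  decode-ups (suc k) = decode-ups k

stepsOf-decodeSteps : ∀ c W → T (returnsFrom c W) → T (avoids stepEq (D ∷ W) DUU) → stepsOf (decodeSteps W) ≡ W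
stepsOf-decodeSteps c [] _ _ = refl
stepsOf-decodeSteps (suc c) (D ∷ W) ret av = cong (D ∷_) (stepsOf-decodeSteps c W ret av)
stepsOf-decodeSteps c (U ∷ D ∷ W) ret av = cong (λ V → U ∷ D ∷ V) (stepsOf-decodeSteps c W ret av)
stepsOf-decodeSteps c (U ∷ U ∷ W) _ ()

encode-decode-from : ∀ c W → T (returnsFrom (suc c) W) → T (avoids stepEq W DUU) →
                     encode (decode W) ≡ replicate (suc c) U ++ W
encode-decode-from c (U ∷ W) ret av =
  trans (encode-decode-from (suc c) W ret av) (sym (++-replicate-∷ (suc c) U W))
encode-decode-from c (D ∷ W) ret av =
  cong₂ (λ k V → replicate (suc k) U ++ D ∷ V) falses≡c steps≡W
  where
  steps≡W : stepsOf (decodeSteps W) ≡ W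
  steps≡W = stepsOf-decodeSteps c W ret av
  falses≡c : falses (decodeSteps W) ≡ c
  falses≡c = sym (ℕP.≡ᵇ⇒≡ c _ (subst T (returnsFrom-stepsOf c (decodeSteps W))
                                         (subst (T ∘ returnsFrom c) (sym steps≡W) ret)))

encode-decode : ∀ p m P → T (inF p (suc m) P) → encode (decode P) ≡ P
encode-decode p m P inP =
  let dyck , avoid = to (T-∧ {isDyck (suc m) P}) inP
      long , returns = to (T-∧ {length P ≡ᵇ 2 ℕ.* suc m}) (subst T (isDyck-returnsFrom (suc m) P) dyck)
  in  startsUp P long returns (proj₁ (to T-∧ avoid))
  where
  startsUp : ∀ P → T (length P ≡ᵇ 2 ℕ.* suc m) → T (returnsFrom 0 P) → T (avoids stepEq P DUU) →
             encode (decode P) ≡ P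
  startsUp [] () _ _
  startsUp (D ∷ _) _ () _
  startsUp (U ∷ W) _ returns avoid = encode-decode-from 0 W returns avoid

-- The Stanley order on encoded paths

ascent : Bool → ℕ
ascent true = 1
ascent false = 0

trues : List Bool → ℕ
trues [] = 0
trues (b ∷ w) = ascent b + trues w

falses+trues : ∀ w → falses w + trues w ≡ length w
falses+trues [] = refl
falses+trues (true ∷ w) = trans (ℕP.+-suc (falses w) (trues w)) (cong suc (falses+trues w))
falses+trues (false ∷ w) = cong suc (falses+trues w)

encode-ascents : ∀ w → encode w ≡ ascents (suc (falses w) ∷ map ascent w)
encode-ascents w = cong (λ V → replicate (suc (falses w)) U ++ D ∷ V) (stepsOf-ascents w)
  where
  stepsOf-ascents : ∀ w → stepsOf w ≡ ascents (map ascent w)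
  stepsOf-ascents [] = refl
  stepsOf-ascents (true ∷ w) = cong (λ V → U ∷ D ∷ V) (stepsOf-ascents w)
  stepsOf-ascents (false ∷ w) = cong (D ∷_) (stepsOf-ascents w)

suffixesDominate : List Bool → List Bool → Bool
suffixesDominate [] [] = true
suffixesDominate (a ∷ x) (b ∷ y) = suffixesDominate x y ∧ (trues (b ∷ y) ≤ᵇ trues (a ∷ x))
suffixesDominate _ _ = false

≤ᵇ-cross : ∀ a b c d → a + c ≡ b + d → (a ≤ᵇ b) ≡ (d ≤ᵇ c)
≤ᵇ-cross a b c d a+c≡b+d =
  T-ext (ℕP.≤⇒≤ᵇ ∘ forward ∘ ℕP.≤ᵇ⇒≤ a b) (ℕP.≤⇒≤ᵇ ∘ backward ∘ ℕP.≤ᵇ⇒≤ d c)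
  where
  forward : a ≤ b → d ≤ c
  forward a≤b = ℕP.+-cancelˡ-≤ b d c (subst (_≤ b + c) a+c≡b+d (ℕP.+-monoˡ-≤ c a≤b))
  backward : d ≤ c → a ≤ b
  backward d≤c = ℕP.+-cancelʳ-≤ c a b (subst (_≤ b + c) (sym a+c≡b+d) (ℕP.+-monoʳ-≤ b d≤c))

belowAscents-suffixesDominate : ∀ α β x y → length x ≡ length y → α + trues x ≡ β + trues y →
  belowAscents 0 α β (map ascent x) (map ascent y) ≡ suffixesDominate x y
belowAscents-suffixesDominate α β [] [] _ eq = ≤ᵇ-cross α β 0 0 eq
belowAscents-suffixesDominate α β (a ∷ x) (b ∷ y) len eq =
  trans (cong₂ _∧_ (≤ᵇ-cross α β (trues (a ∷ x)) (trues (b ∷ y)) eq)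
                   (belowAscents-suffixesDominate (α + ascent a) (β + ascent b) x y (ℕP.suc-injective len)
                     (trans (ℕP.+-assoc α (ascent a) (trues x)) (trans eq (sym (ℕP.+-assoc β (ascent b) (trues y)))))))
        (∧-comm (trues (b ∷ y) ≤ᵇ trues (a ∷ x)) (suffixesDominate x y))

stanleyLe-encode : ∀ x y → length x ≡ length y → stanleyLe (encode x) (encode y) ≡ suffixesDominate x y
stanleyLe-encode x y len = begin
  stanleyLe (encode x) (encode y)
    ≡⟨ belowFrom-slack 0 (+ 0) (encode x) (encode y) ⟩
  below 0 (encode x) (encode y)
    ≡⟨ cong₂ (below 0) (encode-ascents x) (encode-ascents y) ⟩
  below 0 (ascents (suc (falses x) ∷ map ascent x)) (ascents (suc (falses y) ∷ map ascent y))
    ≡⟨ below-ascents 0 (suc (falses x)) (suc (falses y)) (map ascent x) (map ascent y)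
         (subst₂ (λ P Q → length P ≡ length Q) (encode-ascents x) (encode-ascents y) sameLength) ⟩
  belowAscents 0 (suc (falses x)) (suc (falses y)) (map ascent x) (map ascent y)
    ≡⟨ belowAscents-suffixesDominate (suc (falses x)) (suc (falses y)) x y len (cong suc sameCount) ⟩
  suffixesDominate x y
    ∎
  where
  open ≡-Reasoning
  sameLength : length (encode x) ≡ length (encode y)
  sameLength = trans (length-encode x) (trans (cong (λ n → suc n + suc n) len) (sym (length-encode y)))
  sameCount : falses x + trues x ≡ falses y + trues y
  sameCount = trans (falses+trues x) (trans len (sym (falses+trues y)))

startsWithFalses⇒ : ∀ q w → T (startsWithFalses q w) → Σ (List Bool) λ b → w ≡ replicate q false ++ b
startsWithFalses⇒ zero w _ = w , refl
startsWithFalses⇒ (suc q) (false ∷ w) t with startsWithFalses⇒ q w t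
... | b , refl = b , refl

startsWithFalses-++ : ∀ q b → T (startsWithFalses q (replicate q false ++ b))
startsWithFalses-++ zero b = _
startsWithFalses-++ (suc q) b = startsWithFalses-++ q b

startsWithFalses⇒hasFalseRun : ∀ q w → T (startsWithFalses q w) → T (hasFalseRun q w)
startsWithFalses⇒hasFalseRun q [] t = t
startsWithFalses⇒hasFalseRun q (_ ∷ _) t = from T-∨ (inj₁ t)

hasFalseRun⇒ : ∀ q w → T (hasFalseRun q w) → ∃₂ λ a b → w ≡ a ++ replicate q false ++ b
hasFalseRun⇒ q [] t = [] , startsWithFalses⇒ q [] t
hasFalseRun⇒ q (x ∷ w) t with to T-∨ t
... | inj₁ here = [] , startsWithFalses⇒ q (x ∷ w) here
... | inj₂ later with hasFalseRun⇒ q w later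
...   | a , b , refl = x ∷ a , b , refl

hasFalseRun-++ : ∀ q a b → T (hasFalseRun q (a ++ replicate q false ++ b))
hasFalseRun-++ q [] b = startsWithFalses⇒hasFalseRun q _ (startsWithFalses-++ q b)
hasFalseRun-++ q (x ∷ a) b = from T-∨ (inj₂ (hasFalseRun-++ q a b))

hasFalseRun-reverse⇒ : ∀ q w → T (hasFalseRun q w) → T (hasFalseRun q (reverse w))
hasFalseRun-reverse⇒ q w t with hasFalseRun⇒ q w t
... | a , b , refl = subst (T ∘ hasFalseRun q) (sym reversed) (hasFalseRun-++ q (reverse b) (reverse a))
  where
  open ≡-Reasoning
  reversed : reverse (a ++ replicate q false ++ b) ≡ reverse b ++ replicate q false ++ reverse a
  reversed = begin
    reverse (a ++ replicate q false ++ b)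
      ≡⟨ ListP.reverse-++ a (replicate q false ++ b) ⟩
    reverse (replicate q false ++ b) ++ reverse a
      ≡⟨ cong (_++ reverse a) (ListP.reverse-++ (replicate q false) b) ⟩
    (reverse b ++ reverse (replicate q false)) ++ reverse a
      ≡⟨ cong (λ r → (reverse b ++ r) ++ reverse a) (reverse-replicate q false) ⟩
    (reverse b ++ replicate q false) ++ reverse a
      ≡⟨ ListP.++-assoc (reverse b) (replicate q false) (reverse a) ⟩
    reverse b ++ replicate q false ++ reverse a
      ∎

hasFalseRun-reverse : ∀ q w → hasFalseRun q (reverse w) ≡ hasFalseRun q w
hasFalseRun-reverse q w =
  T-ext (subst (T ∘ hasFalseRun q) (ListP.reverse-involutive w) ∘ hasFalseRun-reverse⇒ q (reverse w))
        (hasFalseRun-reverse⇒ q w)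

module _ {A : Set} (eq : A → A → Bool) (letters : List A) (π : A → Bool)
         (π-spec : ∀ b → any (λ a → eq a b) letters ≡ not (π b)) where

  anyPrefix-wordsOver : ∀ q s → any (λ u → isPrefix eq u s) (wordsOver letters q) ≡ startsWithFalses q (map π s)
  anyPrefix-wordsOver zero s = refl
  anyPrefix-wordsOver (suc q) [] = begin
    any (λ u → isPrefix eq u []) (wordsOver letters (suc q))
      ≡⟨ any-concatMap _ _ letters ⟩
    any (λ a → any (λ u → isPrefix eq u []) (map (a ∷_) W)) letters
      ≡⟨ any-cong (λ a → trans (any-map (λ u → isPrefix eq u []) (a ∷_) W) (any-false W)) letters ⟩
    any (λ _ → false) letters
      ≡⟨ any-false letters ⟩
    false
      ∎
    where
    open ≡-Reasoning
    W : List (List A)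
    W = wordsOver letters q
  anyPrefix-wordsOver (suc q) (b ∷ s) = begin
    any (λ u → isPrefix eq u (b ∷ s)) (wordsOver letters (suc q))
      ≡⟨ any-concatMap _ _ letters ⟩
    any (λ a → any (λ u → isPrefix eq u (b ∷ s)) (map (a ∷_) W)) letters
      ≡⟨ any-cong (λ a → trans (any-map (λ u → isPrefix eq u (b ∷ s)) (a ∷_) W)
                               (any-∧ˡ (eq a b) (λ u → isPrefix eq u s) W)) letters ⟩
    any (λ a → eq a b ∧ any (λ u → isPrefix eq u s) W) letters
      ≡⟨ any-∧ʳ (λ a → eq a b) (any (λ u → isPrefix eq u s) W) letters ⟩
    any (λ a → eq a b) letters ∧ any (λ u → isPrefix eq u s) W
      ≡⟨ cong₂ _∧_ (π-spec b) (anyPrefix-wordsOver q s) ⟩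
    not (π b) ∧ startsWithFalses q (map π s)
      ∎
    where
    open ≡-Reasoning
    W : List (List A)
    W = wordsOver letters q

  anyFactor-wordsOver : ∀ q z → any (λ u → isFactor eq u z) (wordsOver letters q) ≡ hasFalseRun q (map π z)
  anyFactor-wordsOver q [] = anyPrefix-wordsOver q []
  anyFactor-wordsOver q (b ∷ z) =
    trans (any-∨ (λ u → isPrefix eq u (b ∷ z)) (λ u → isFactor eq u z) (wordsOver letters q))
          (cong₂ _∨_ (anyPrefix-wordsOver q (b ∷ z)) (anyFactor-wordsOver q z))

-- Bicolored Motzkin words as pairs of binary words

pairOf : MStep → Bool × Bool
pairOf MU = true , false
pairOf MD = false , true
pairOf F₁ = true , true
pairOf F₂ = false , false

stepOf : Bool → Bool → MStep
stepOf true false = MU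
stepOf false true = MD
stepOf true true = F₁
stepOf false false = F₂

lower upper : MStep → Bool
lower = proj₁ ∘ pairOf
upper = proj₂ ∘ pairOf

unpair : List MStep → List Bool × List Bool
unpair z = unzipWith pairOf (reverse z)

pair : List Bool × List Bool → List MStep
pair (x , y) = reverse (zipWith stepOf x y)

pair-unpair : ∀ z → pair (unpair z) ≡ z
pair-unpair z =
  trans (cong reverse (ListP.zipWith-unzipWith pairOf stepOf stepOf-pairOf (reverse z))) (ListP.reverse-involutive z)
  where
  stepOf-pairOf : ∀ s → uncurry′ stepOf (pairOf s) ≡ s
  stepOf-pairOf MU = refl
  stepOf-pairOf MD = refl
  stepOf-pairOf F₁ = refl
  stepOf-pairOf F₂ = refl

unpair-pair : ∀ x y → length x ≡ length y → unpair (pair (x , y)) ≡ (x , y)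
unpair-pair x y len =
  trans (cong (unzipWith pairOf) (ListP.reverse-involutive (zipWith stepOf x y)))
        (ListP.unzipWith-zipWith pairOf stepOf pairOf-stepOf x y len)
  where
  pairOf-stepOf : ∀ ab → pairOf (uncurry′ stepOf ab) ≡ ab
  pairOf-stepOf (true , true) = refl
  pairOf-stepOf (true , false) = refl
  pairOf-stepOf (false , true) = refl
  pairOf-stepOf (false , false) = refl

avoidsAll-runs : ∀ p z → avoidsAll p z ≡ not (hasFalseRun p (map upper z)) ∧ not (hasFalseRun p (map lower z))
avoidsAll-runs p z = begin
  allB (avoids mstepEq z) (forbidden p)
    ≡⟨ allB-++ (avoids mstepEq z) (wordsOver (F₂ ∷ MU ∷ []) p) _ ⟩
  allB (avoids mstepEq z) (wordsOver (F₂ ∷ MU ∷ []) p) ∧ allB (avoids mstepEq z) (wordsOver (F₂ ∷ MD ∷ []) p)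
    ≡⟨ cong₂ _∧_ (allB-not (λ u → isFactor mstepEq u z) (wordsOver (F₂ ∷ MU ∷ []) p))
                 (allB-not (λ u → isFactor mstepEq u z) (wordsOver (F₂ ∷ MD ∷ []) p)) ⟩
  not (any (λ u → isFactor mstepEq u z) (wordsOver (F₂ ∷ MU ∷ []) p)) ∧
  not (any (λ u → isFactor mstepEq u z) (wordsOver (F₂ ∷ MD ∷ []) p))
    ≡⟨ cong₂ (λ a b → not a ∧ not b) (anyFactor-wordsOver mstepEq _ upper upper-spec p z)
                                      (anyFactor-wordsOver mstepEq _ lower lower-spec p z) ⟩
  not (hasFalseRun p (map upper z)) ∧ not (hasFalseRun p (map lower z))
    ∎
  where
  open ≡-Reasoning
  upper-spec : ∀ b → any (λ a → mstepEq a b) (F₂ ∷ MU ∷ []) ≡ not (upper b)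
  upper-spec MU = refl
  upper-spec MD = refl
  upper-spec F₁ = refl
  upper-spec F₂ = refl
  lower-spec : ∀ b → any (λ a → mstepEq a b) (F₂ ∷ MD ∷ []) ≡ not (lower b)
  lower-spec MU = refl
  lower-spec MD = refl
  lower-spec F₁ = refl
  lower-spec F₂ = refl

heightsFrom-∷ʳ : ∀ {A : Set} (f : A → ℤ) h w s →
  heightsFrom f h (w ∷ʳ s) ≡ heightsFrom f h w ∷ʳ foldl (λ k t → k ℤ.+ f t) h (w ∷ʳ s)
heightsFrom-∷ʳ f h [] s = refl
heightsFrom-∷ʳ f h (t ∷ w) s = cong (h ∷_) (heightsFrom-∷ʳ f (h ℤ.+ f t) w s)

pair-∷ : ∀ a b x y → pair (a ∷ x , b ∷ y) ≡ pair (x , y) ∷ʳ stepOf a b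
pair-∷ a b x y = ListP.unfold-reverse (stepOf a b) (zipWith stepOf x y)

endHeight : List MStep → ℤ
endHeight = foldl (λ k t → k ℤ.+ mδ t) (+ 0)

mδ-stepOf : ∀ a b → mδ (stepOf a b) ≡ + ascent a ℤ.- + ascent b
mδ-stepOf true true = refl
mδ-stepOf true false = refl
mδ-stepOf false true = refl
mδ-stepOf false false = refl

endHeight-pair : ∀ x y → length x ≡ length y → endHeight (pair (x , y)) ≡ + trues x ℤ.- + trues y
endHeight-pair [] [] _ = refl
endHeight-pair (a ∷ x) (b ∷ y) len = begin
  endHeight (pair (a ∷ x , b ∷ y))
    ≡⟨ cong endHeight (pair-∷ a b x y) ⟩
  endHeight (pair (x , y) ∷ʳ stepOf a b)
    ≡⟨ ListP.foldl-∷ʳ (λ k t → k ℤ.+ mδ t) (+ 0) (stepOf a b) (pair (x , y)) ⟩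
  endHeight (pair (x , y)) ℤ.+ mδ (stepOf a b)
    ≡⟨ cong₂ ℤ._+_ (endHeight-pair x y (ℕP.suc-injective len)) (mδ-stepOf a b) ⟩
  (+ trues x ℤ.- + trues y) ℤ.+ (+ ascent a ℤ.- + ascent b)
    ≡⟨ regroup (+ trues x) (+ trues y) (+ ascent a) (+ ascent b) ⟩
  (+ ascent a ℤ.+ + trues x) ℤ.- (+ ascent b ℤ.+ + trues y)
    ≡⟨ cong₂ ℤ._-_ (ℤP.pos-+ (ascent a) (trues x)) (ℤP.pos-+ (ascent b) (trues y)) ⟨
  + trues (a ∷ x) ℤ.- + trues (b ∷ y)
    ∎
  where
  open ≡-Reasoning
  regroup : ∀ tx ty da db → (tx ℤ.- ty) ℤ.+ (da ℤ.- db) ≡ (da ℤ.+ tx) ℤ.- (db ℤ.+ ty)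
  regroup = solve-∀

nonneg-minus : ∀ m n → nonneg (+ m ℤ.- + n) ≡ (n ≤ᵇ m)
nonneg-minus m n = trans (cong nonneg (ℤP.m-n≡m⊖n m n)) (nonneg-⊖ m n)
  where
  nonneg-⊖ : ∀ m n → nonneg (m ℤ.⊖ n) ≡ (n ≤ᵇ m)
  nonneg-⊖ m zero = refl
  nonneg-⊖ zero (suc n) = refl
  nonneg-⊖ (suc m) (suc n) =
    trans (cong nonneg (ℤP.[1+m]⊖[1+n]≡m⊖n m n)) (trans (nonneg-⊖ m n) (sym (≤ᵇ-suc n m)))

nonneg-pair : ∀ x y → length x ≡ length y → allB nonneg (heightsFrom mδ (+ 0) (pair (x , y))) ≡ suffixesDominate x y
nonneg-pair [] [] _ = refl
nonneg-pair (a ∷ x) (b ∷ y) len = begin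
  allB nonneg (heightsFrom mδ (+ 0) (pair (a ∷ x , b ∷ y)))
    ≡⟨ cong (allB nonneg ∘ heightsFrom mδ (+ 0)) (pair-∷ a b x y) ⟩
  allB nonneg (heightsFrom mδ (+ 0) (pair (x , y) ∷ʳ stepOf a b))
    ≡⟨ cong (allB nonneg) (heightsFrom-∷ʳ mδ (+ 0) (pair (x , y)) (stepOf a b)) ⟩
  allB nonneg (heightsFrom mδ (+ 0) (pair (x , y)) ∷ʳ endHeight (pair (x , y) ∷ʳ stepOf a b))
    ≡⟨ allB-∷ʳ nonneg (heightsFrom mδ (+ 0) (pair (x , y))) (endHeight (pair (x , y) ∷ʳ stepOf a b)) ⟩
  allB nonneg (heightsFrom mδ (+ 0) (pair (x , y))) ∧ nonneg (endHeight (pair (x , y) ∷ʳ stepOf a b))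
    ≡⟨ cong₂ _∧_ (nonneg-pair x y (ℕP.suc-injective len))
                 (cong nonneg (trans (cong endHeight (sym (pair-∷ a b x y))) (endHeight-pair (a ∷ x) (b ∷ y) len))) ⟩
  suffixesDominate x y ∧ nonneg (+ trues (a ∷ x) ℤ.- + trues (b ∷ y))
    ≡⟨ cong (suffixesDominate x y ∧_) (nonneg-minus (trues (a ∷ x)) (trues (b ∷ y))) ⟩
  suffixesDominate (a ∷ x) (b ∷ y)
    ∎
  where open ≡-Reasoning

bothIn-encode : ∀ p m x y →
  bothIn (inF p (suc m)) stanleyLe (encode x , encode y) ≡ bothIn (isCodeWord p m) suffixesDominate (x , y)
bothIn-encode p m x y =
  trans (cong₂ (λ a b → a ∧ (b ∧ stanleyLe (encode x) (encode y))) (inF-encode p m x) (inF-encode p m y))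
        (∧-cong-T (isCodeWord p m x) λ x-ok → ∧-cong-T (isCodeWord p m y) λ y-ok →
          stanleyLe-encode x y (trans (isCodeWord-length p m x x-ok) (sym (isCodeWord-length p m y y-ok))))

intervals↔codes : ∀ p m → Σ (List Step × List Step) (T ∘ bothIn (inF p (suc m)) stanleyLe) ↔
                          Σ (List Bool × List Bool) (T ∘ bothIn (isCodeWord p m) suffixesDominate)
intervals↔codes p m =
  restrict↔ (Product.map encode encode) (Product.map decode decode)
    (λ (x , y) → bothIn-encode p m x y)
    (λ (x , y) → cong₂ _,_ (decode-encode x) (decode-encode y))
    (λ (P , Q) inPQ → let inP , inQ∧PQ = to (T-∧ {inF p (suc m) P}) inPQ
                      in cong₂ _,_ (encode-decode p m P inP) (encode-decode p m Q (proj₁ (to T-∧ inQ∧PQ))))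

isCodeWord-reverse : ∀ p m (g : MStep → Bool) z →
  isCodeWord p m (map g (reverse z)) ≡ (length z ≡ᵇ m) ∧ not (hasFalseRun p (map g z))
isCodeWord-reverse p m g z =
  cong₂ (λ l r → (l ≡ᵇ m) ∧ not r)
        (trans (ListP.length-map g (reverse z)) (ListP.length-reverse z))
        (trans (cong (hasFalseRun p) (ListP.reverse-map g z)) (hasFalseRun-reverse p (map g z)))

bothIn-unpair : ∀ p m z → bothIn (isCodeWord p m) suffixesDominate (unpair z) ≡ (isBiMotzkin m z ∧ avoidsAll p z)
bothIn-unpair p m z = begin
  bothIn (isCodeWord p m) suffixesDominate (unpair z)
    ≡⟨ cong₂ _∧_ (trans (cong (isCodeWord p m) (proj₁-unzipWith pairOf (reverse z)))
                        (isCodeWord-reverse p m lower z))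
                 (cong₂ _∧_ (trans (cong (isCodeWord p m) (proj₂-unzipWith pairOf (reverse z)))
                                   (isCodeWord-reverse p m upper z))
                            nonnegative) ⟩
  ((length z ≡ᵇ m) ∧ not (hasFalseRun p (map lower z))) ∧
  (((length z ≡ᵇ m) ∧ not (hasFalseRun p (map upper z))) ∧ allB nonneg (heightsFrom mδ (+ 0) z))
    ≡⟨ ∧-shuffle (length z ≡ᵇ m) _ _ _ ⟩
  isBiMotzkin m z ∧ (not (hasFalseRun p (map upper z)) ∧ not (hasFalseRun p (map lower z)))
    ≡⟨ cong (isBiMotzkin m z ∧_) (avoidsAll-runs p z) ⟨
  isBiMotzkin m z ∧ avoidsAll p z
    ∎
  where
  open ≡-Reasoning
  sameLength : length (proj₁ (unpair z)) ≡ length (proj₂ (unpair z))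
  sameLength = trans (ListP.length-unzipWith₁ pairOf (reverse z))
                     (sym (ListP.length-unzipWith₂ pairOf (reverse z)))
  nonnegative : suffixesDominate (proj₁ (unpair z)) (proj₂ (unpair z)) ≡ allB nonneg (heightsFrom mδ (+ 0) z)
  nonnegative = trans (sym (nonneg-pair (proj₁ (unpair z)) (proj₂ (unpair z)) sameLength))
                      (cong (allB nonneg ∘ heightsFrom mδ (+ 0)) (pair-unpair z))

codes↔motzkin : ∀ p m → Σ (List Bool × List Bool) (T ∘ bothIn (isCodeWord p m) suffixesDominate) ↔ Motz p m
codes↔motzkin p m =
  restrict↔ unpair pair (bothIn-unpair p m) pair-unpair
    (λ (x , y) ok → let x-ok , y-ok∧dom = to (T-∧ {isCodeWord p m x}) ok
                    in unpair-pair x y (trans (isCodeWord-length p m x x-ok)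
                                              (sym (isCodeWord-length p m y (proj₁ (to T-∧ y-ok∧dom))))))

theorem4p8 : (p : ℕ) → 3 ≤ p → (n : ℕ) → 1 ≤ n → Interval p n ⤖ Motz p (n ∸ 1)
theorem4p8 p _ zero ()
theorem4p8 p _ (suc m) _ =
  ↔⇒⤖ (codes↔motzkin p m ↔-∘ (intervals↔codes p m ↔-∘ pairsIn↔ {P = inF p (suc m)} stanleyLe))
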